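{- Let $G$ be a connected bipartite simple graph with bipartition $(V_1,V_2)$ and vertex set $\{v_1,\ldots,v_n\}$, with edge cone $\mathbb{R}_+\mathcal{A}$, and let $\mathcal{F}$ be the family of independent sets $B$ of $G$ such that $H_B\cap\mathbb{R}_+\mathcal{A}$ is a facet of $\mathbb{R}_+\mathcal{A}$. If $A\in\mathcal{F}$ and $A\cap V_1\neq\emptyset$ and $A\cap V_2\neq\emptyset$, then the halfspace $H_A^-$ is redundant in the expression $$\mathrm{aff}(\mathbb{R}_+\mathcal{A})\cap\left(\bigcap_{B\in\mathcal{F}}H_B^-\right)\cap\left(\bigcap_{i=1}^nH_{e_i}^+\right)$$ of the edge cone, i.e. omitting $H_A^-$ from this intersection does not change it.
   Context: $e_i$ is the $i$-th unit vector of $\mathbb{R}^n$; $H_{e_i}^+=\{x\mid x_i\ge0\}$. The edge cone $\mathbb{R}_+\mathcal{A}$ is the cone of nonnegative real combinations of the vectors $e_i+e_j$ with $\{v_i,v_j\}$ an edge of $G$; $\mathrm{aff}$ denotes affine hull. A set of vertices is independent if no two of its vertices are adjacent; $N(B)$ is the set of vertices adjacent to some vertex of $B$; $H_B=\{x\mid\sum_{v_i\in B}x_i=\sum_{v_i\in N(B)}x_i\}$ and $H_B^-=\{x\mid\sum_{v_i\in B}x_i\le\sum_{v_i\in N(B)}x_i\}$. A facet of a cone $Q$ is a set $Q\cap H$, $H$ a hyperplane through the origin with $Q$ on one side of $H$, of dimension $\dim Q-1$.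
   Formalization: Stated over ℚ^n instead of ℝ^n: the edge cone uses nonnegative rational combinations, and the affine hull, halfspaces, facets and the points of both intersections have rational coordinates. -}

module Defs where

open import Data.Nat using (ℕ; zero; suc)
open import Data.Fin using (Fin; zero; suc; _≟_)
open import Data.Bool using (Bool; true; false; if_then_else_; _∧_; _∨_)
open import Data.Rational using (ℚ; 0ℚ; 1ℚ; _+_; _*_; _≤_)
open import Data.Product using (Σ; ∃; ∃-syntax; _×_; _,_; proj₁; proj₂)
open import Relation.Nullary using (¬_; does)
open import Relation.Binary.PropositionalEquality using (_≡_; _≢_)

-- Points of ℚⁿ (stand-in for ℝⁿ) and sets of points

Point : ℕ → Set
Point n = Fin n → ℚ

PointSet : ℕ → Set₁
PointSet n = Point n → Set

sumFin : ∀ {m} → (Fin m → ℚ) → ℚ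
sumFin {zero}  f = 0ℚ
sumFin {suc m} f = f zero + sumFin {m} (λ i → f (suc i))

_≐_ : ∀ {n} → Point n → Point n → Set
x ≐ y = ∀ k → x k ≡ y k

lincomb : ∀ {n m} → (Fin m → ℚ) → (Fin m → Point n) → Point n
lincomb c p k = sumFin (λ t → c t * p t k)

unit : ∀ {n} → Fin n → Point n
unit i k = if does (i ≟ k) then 1ℚ else 0ℚ

record SimpleGraph (n : ℕ) : Set where
  field
    adj     : Fin n → Fin n → Bool
    symm    : ∀ i j → adj i j ≡ adj j i
    irrefl  : ∀ i → adj i i ≡ false

open SimpleGraph public

data Walk {n} (G : SimpleGraph n) : Fin n → Fin n → Set where
  here : ∀ {i} → Walk G i i
  step : ∀ {i j k} → adj G i j ≡ true → Walk G j k → Walk G i k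

Connected : ∀ {n} → SimpleGraph n → Set
Connected G = ∀ i j → Walk G i j

-- (V₁ , V₂) given by side : V₁ = {i | side i ≡ true}, V₂ = {i | side i ≡ false};
-- it is a bipartition of G when every edge joins V₁ and V₂.
IsBipartition : ∀ {n} → SimpleGraph n → (Fin n → Bool) → Set
IsBipartition G side = ∀ i j → adj G i j ≡ true → side i ≢ side j

VSet : ℕ → Set
VSet n = Fin n → Bool

Independent : ∀ {n} → SimpleGraph n → VSet n → Set
Independent G B = ∀ i j → B i ≡ true → B j ≡ true → adj G i j ≡ false

anyFin : ∀ {m} → (Fin m → Bool) → Bool
anyFin {zero}  f = false
anyFin {suc m} f = f zero ∨ anyFin {m} (λ i → f (suc i))

nbhd : ∀ {n} → SimpleGraph n → VSet n → VSet n
nbhd G B i = anyFin (λ j → B j ∧ adj G j i)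

sumOver : ∀ {n} → VSet n → Point n → ℚ
sumOver S x = sumFin (λ i → if S i then x i else 0ℚ)

H : ∀ {n} → SimpleGraph n → VSet n → PointSet n
H G B x = sumOver B x ≡ sumOver (nbhd G B) x

H⁻ : ∀ {n} → SimpleGraph n → VSet n → PointSet n
H⁻ G B x = sumOver B x ≤ sumOver (nbhd G B) x

He⁺ : ∀ {n} → Fin n → PointSet n
He⁺ i x = 0ℚ ≤ x i

edgeVec : ∀ {n} → Fin n × Fin n → Point n
edgeVec (i , j) k = unit i k + unit j k

EdgeCone : ∀ {n} → SimpleGraph n → PointSet n
EdgeCone {n} G x =
  ∃[ m ] Σ (Fin m → Fin n × Fin n) λ es → Σ (Fin m → ℚ) λ c →
    (∀ t → adj G (proj₁ (es t)) (proj₂ (es t)) ≡ true) ×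
    (∀ t → 0ℚ ≤ c t) ×
    (x ≐ lincomb c (λ t → edgeVec (es t)))

aff : ∀ {n} → PointSet n → PointSet n
aff {n} S x =
  ∃[ m ] Σ (Fin m → Point n) λ p → Σ (Fin m → ℚ) λ c →
    (∀ t → S (p t)) × (sumFin c ≡ 1ℚ) × (x ≐ lincomb c p)

AffinelyIndependent : ∀ {n m} → (Fin m → Point n) → Set
AffinelyIndependent p =
  ∀ c → sumFin c ≡ 0ℚ → lincomb c p ≐ (λ _ → 0ℚ) → ∀ t → c t ≡ 0ℚ

HasDim : ∀ {n} → PointSet n → ℕ → Set
HasDim {n} S d =
  (Σ (Fin (suc d) → Point n) λ p → (∀ t → S (p t)) × AffinelyIndependent p) ×
  (∀ (p : Fin (suc (suc d)) → Point n) → (∀ t → S (p t)) → ¬ AffinelyIndependent p)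

dot : ∀ {n} → Point n → Point n → ℚ
dot a x = sumFin (λ k → a k * x k)

IsFacet : ∀ {n} → PointSet n → PointSet n → Set
IsFacet {n} Q F =
  Σ (Point n) λ a →
    (¬ (a ≐ (λ _ → 0ℚ))) ×
    (∀ x → Q x → 0ℚ ≤ dot a x) ×
    (∀ x → (F x → Q x × dot a x ≡ 0ℚ) × (Q x × dot a x ≡ 0ℚ → F x)) ×
    (∃[ d ] HasDim Q (suc d) × HasDim F d)

InFamily : ∀ {n} → SimpleGraph n → VSet n → Set
InFamily G B = Independent G B × IsFacet (EdgeCone G) (λ x → EdgeCone G x × H G B x)

FullIntersection : ∀ {n} → SimpleGraph n → PointSet n
FullIntersection G x =
  aff (EdgeCone G) x × (∀ B → InFamily G B → H⁻ G B x) × (∀ i → He⁺ i x)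

OmitIntersection : ∀ {n} → SimpleGraph n → VSet n → PointSet n
OmitIntersection G A x =
  aff (EdgeCone G) x ×
  (∀ B → InFamily G B → ¬ (∀ i → B i ≡ A i) → H⁻ G B x) ×
  (∀ i → He⁺ i x)

-- Split A along the bipartition into A₁ = A ∩ V₁ and A₂ = A ∩ V₂, both nonempty and both
-- different from A. As G is bipartite, N(A) is the disjoint union of N(A₁) and N(A₂), so the
-- inequality of H_A⁻ is the sum of those of H_{A₁}⁻ and H_{A₂}⁻; it remains to see Aᵢ ∈ 𝓕.
-- Every H_B⁻ is valid on the edge cone, hence the facet ℝ₊𝒜 ∩ H_A lies in the face ℝ₊𝒜 ∩ H_{Aᵢ}.
-- That face is proper (by connectivity some edge leaves Aᵢ ∪ N(Aᵢ)), and a proper face containing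
-- a facet is that facet.
{-# OPTIONS --safe #-}
module Submission where

open import Defs
open import Algebra.Bundles using (CommutativeMonoid; CommutativeRing)
open import Data.Bool using (Bool; true; false; if_then_else_; _∧_; _∨_; not)
import Data.Bool.Properties as 𝔹
open import Data.Empty using (⊥-elim)
open import Data.Fin using (Fin; zero; suc)
import Data.Fin.Properties as Fin
open import Data.Nat using (zero; suc)
open import Data.Product using (∃-syntax; _×_; _,_; proj₁; proj₂)
open import Data.Rational using (ℚ; 0ℚ; 1ℚ; _+_; _*_; _-_; -_; _≤_; 1/_; ≢-nonZero; nonNegative)
import Data.Rational.Properties as ℚ
open import Data.Vec.Functional using (_∷_)
open import Function using (_∘_)
open import Relation.Nullary using (¬_; yes; no)
open import Relation.Binary.PropositionalEquality
open import Algebra.Properties.Semiring.Sum (CommutativeRing.semiring ℚ.+-*-commutativeRing)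
  using (sum; ∑-distrib-+; ∑-comm; *-distribˡ-sum)
open import Algebra.Properties.Group ℚ.+-0-group using (x∙y⁻¹≈ε⇒x≈y; x≈y⇒x∙y⁻¹≈ε)
open ≡-Reasoning

*≡0⇒≡0 : ∀ {c u} → c * u ≡ 0ℚ → u ≢ 0ℚ → c ≡ 0ℚ
*≡0⇒≡0 {c} {u} cu≡0 u≢0 = begin
  c                ≡⟨ ℚ.*-identityʳ c ⟨
  c * 1ℚ           ≡⟨ cong (c *_) (ℚ.*-inverseʳ u) ⟨
  c * (u * 1/ u)   ≡⟨ ℚ.*-assoc c u (1/ u) ⟨
  c * u * 1/ u     ≡⟨ cong (_* 1/ u) cu≡0 ⟩
  0ℚ * 1/ u        ≡⟨ ℚ.*-zeroˡ (1/ u) ⟩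
  0ℚ               ∎
  where instance _ = ≢-nonZero u≢0

+-mono-≤-≡⇒≡ : ∀ {a₁ a₂ b₁ b₂} → a₁ ≤ b₁ → a₂ ≤ b₂ → a₁ + a₂ ≡ b₁ + b₂ → a₁ ≡ b₁ × a₂ ≡ b₂
+-mono-≤-≡⇒≡ a₁≤b₁ a₂≤b₂ Σa≡Σb =
  ℚ.≤-antisym a₁≤b₁ (ℚ.≮⇒≥ (λ a₁<b₁ → ℚ.<⇒≢ (ℚ.+-mono-<-≤ a₁<b₁ a₂≤b₂) Σa≡Σb)) ,
  ℚ.≤-antisym a₂≤b₂ (ℚ.≮⇒≥ (λ a₂<b₂ → ℚ.<⇒≢ (ℚ.+-mono-≤-< a₁≤b₁ a₂<b₂) Σa≡Σb))

sumFin≡sum : ∀ {m} (f : Fin m → ℚ) → sumFin f ≡ sum f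
sumFin≡sum {zero}  f = refl
sumFin≡sum {suc m} f = cong (f zero +_) (sumFin≡sum (f ∘ suc))

sumFin-cong : ∀ {m} {f g : Fin m → ℚ} → (∀ i → f i ≡ g i) → sumFin f ≡ sumFin g
sumFin-cong {zero}  f≗g = refl
sumFin-cong {suc m} f≗g = cong₂ _+_ (f≗g zero) (sumFin-cong (f≗g ∘ suc))

sumFin-0 : ∀ {m} {f : Fin m → ℚ} → (∀ i → f i ≡ 0ℚ) → sumFin f ≡ 0ℚ
sumFin-0 {zero}  f≗0 = refl
sumFin-0 {suc m} f≗0 = trans (cong₂ _+_ (f≗0 zero) (sumFin-0 (f≗0 ∘ suc))) (ℚ.+-identityˡ 0ℚ)

sumFin-+ : ∀ {m} (f g : Fin m → ℚ) → sumFin (λ i → f i + g i) ≡ sumFin f + sumFin g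
sumFin-+ f g = begin
  sumFin (λ i → f i + g i) ≡⟨ sumFin≡sum (λ i → f i + g i) ⟩
  sum (λ i → f i + g i)    ≡⟨ ∑-distrib-+ f g ⟩
  sum f + sum g            ≡⟨ cong₂ _+_ (sumFin≡sum f) (sumFin≡sum g) ⟨
  sumFin f + sumFin g      ∎

sumFin-neg : ∀ {m} (f : Fin m → ℚ) → sumFin (λ i → - f i) ≡ - sumFin f
sumFin-neg {zero}  f = refl
sumFin-neg {suc m} f =
  trans (cong (- f zero +_) (sumFin-neg (f ∘ suc))) (sym (ℚ.neg-distrib-+ (f zero) _))

sumFin-*ˡ : ∀ {m} (c : ℚ) (f : Fin m → ℚ) → sumFin (λ i → c * f i) ≡ c * sumFin f
sumFin-*ˡ c f = begin
  sumFin (λ i → c * f i) ≡⟨ sumFin≡sum (λ i → c * f i) ⟩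
  sum (λ i → c * f i)    ≡⟨ *-distribˡ-sum c f ⟨
  c * sum f              ≡⟨ cong (c *_) (sumFin≡sum f) ⟨
  c * sumFin f           ∎

sumFin-comm : ∀ {m k} (f : Fin m → Fin k → ℚ) →
  sumFin (λ s → sumFin (f s)) ≡ sumFin (λ t → sumFin (λ s → f s t))
sumFin-comm f = trans (sumFin²≡sum² f) (trans (∑-comm f) (sym (sumFin²≡sum² (λ t s → f s t))))
  where
  sumFin²≡sum² : ∀ {m k} (g : Fin m → Fin k → ℚ) →
    sumFin (λ s → sumFin (g s)) ≡ sum (λ s → sum (g s))
  sumFin²≡sum² g = trans (sumFin-cong (sumFin≡sum ∘ g)) (sumFin≡sum (λ s → sum (g s)))

sumFin-mono-≤ : ∀ {m} {f g : Fin m → ℚ} → (∀ i → f i ≤ g i) → sumFin f ≤ sumFin g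
sumFin-mono-≤ {zero}  f≤g = ℚ.≤-refl
sumFin-mono-≤ {suc m} f≤g = ℚ.+-mono-≤ (f≤g zero) (sumFin-mono-≤ (f≤g ∘ suc))

dot-cong : ∀ {n} (a : Point n) {x y : Point n} → x ≐ y → dot a x ≡ dot a y
dot-cong a x≐y = sumFin-cong (cong (a _ *_) ∘ x≐y)

dot-zeroʳ : ∀ {n} (a : Point n) → dot a (λ _ → 0ℚ) ≡ 0ℚ
dot-zeroʳ a = sumFin-0 (ℚ.*-zeroʳ ∘ a)

dot-+ʳ : ∀ {n} (a x y : Point n) → dot a (λ k → x k + y k) ≡ dot a x + dot a y
dot-+ʳ a x y =
  trans (sumFin-cong (λ k → ℚ.*-distribˡ-+ (a k) (x k) (y k))) (sumFin-+ (λ k → a k * x k) _)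

dot--ˡ : ∀ {n} (u v x : Point n) → dot (λ k → u k - v k) x ≡ dot u x - dot v x
dot--ˡ u v x = begin
  sumFin (λ k → (u k - v k) * x k)
    ≡⟨ sumFin-cong (λ k → ℚ.*-distribʳ-+ (x k) (u k) (- v k)) ⟩
  sumFin (λ k → u k * x k + - v k * x k)
    ≡⟨ sumFin-cong (λ k → cong (u k * x k +_) (sym (ℚ.neg-distribˡ-* (v k) (x k)))) ⟩
  sumFin (λ k → u k * x k + - (v k * x k))
    ≡⟨ sumFin-+ (λ k → u k * x k) _ ⟩
  dot u x + sumFin (λ k → - (v k * x k))
    ≡⟨ cong (dot u x +_) (sumFin-neg (λ k → v k * x k)) ⟩
  dot u x - dot v x ∎

dot-lincomb : ∀ {n m} (a : Point n) (c : Fin m → ℚ) (p : Fin m → Point n) →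
  dot a (lincomb c p) ≡ sumFin (λ t → c t * dot a (p t))
dot-lincomb a c p = begin
  sumFin (λ k → a k * sumFin (λ t → c t * p t k))
    ≡⟨ sumFin-cong (λ k → sumFin-*ˡ (a k) (λ t → c t * p t k)) ⟨
  sumFin (λ k → sumFin (λ t → a k * (c t * p t k)))
    ≡⟨ sumFin-comm (λ k t → a k * (c t * p t k)) ⟩
  sumFin (λ t → sumFin (λ k → a k * (c t * p t k)))
    ≡⟨ sumFin-cong (λ t → sumFin-cong (λ k → x∙yz≈y∙xz (a k) (c t) (p t k))) ⟩
  sumFin (λ t → sumFin (λ k → c t * (a k * p t k)))
    ≡⟨ sumFin-cong (λ t → sumFin-*ˡ (c t) (λ k → a k * p t k)) ⟩
  sumFin (λ t → c t * dot a (p t)) ∎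
  where
  open import Algebra.Properties.CommutativeSemigroup
    (CommutativeMonoid.commutativeSemigroup ℚ.*-1-commutativeMonoid) using (x∙yz≈y∙xz)

dot-unit : ∀ {n} (a : Point n) (i : Fin n) → dot a (unit i) ≡ a i
dot-unit {suc n} a zero = begin
  a zero * 1ℚ + dot (a ∘ suc) (λ _ → 0ℚ)
    ≡⟨ cong₂ _+_ (ℚ.*-identityʳ (a zero)) (dot-zeroʳ (a ∘ suc)) ⟩
  a zero + 0ℚ                             ≡⟨ ℚ.+-identityʳ (a zero) ⟩
  a zero                                  ∎
dot-unit {suc n} a (suc i) = begin
  a zero * 0ℚ + dot (a ∘ suc) (unit i) ≡⟨ cong₂ _+_ (ℚ.*-zeroʳ (a zero)) (dot-unit (a ∘ suc) i) ⟩
  0ℚ + a (suc i)                       ≡⟨ ℚ.+-identityˡ (a (suc i)) ⟩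
  a (suc i)                            ∎

dot-edgeVec : ∀ {n} (a : Point n) (i j : Fin n) → dot a (edgeVec (i , j)) ≡ a i + a j
dot-edgeVec a i j = trans (dot-+ʳ a (unit i) (unit j)) (cong₂ _+_ (dot-unit a i) (dot-unit a j))

AffinelyIndependent-∷ : ∀ {n m} (a y : Point n) {p : Fin m → Point n} →
  AffinelyIndependent p → (∀ t → dot a (p t) ≡ 0ℚ) → dot a y ≢ 0ℚ →
  AffinelyIndependent (y ∷ p)
AffinelyIndependent-∷ a y {p} p-indep a[p]≡0 a[y]≢0 c Σc≡0 Σcq≐0 = λ where
    zero    → c₀≡0
    (suc t) → p-indep (c ∘ suc) (drop c₀≡0 Σc≡0) (λ k → drop (c₀y≡0 k) (Σcq≐0 k)) t
  where
  drop : ∀ {s r} → s ≡ 0ℚ → s + r ≡ 0ℚ → r ≡ 0ℚ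
  drop {r = r} refl s+r≡0 = trans (sym (ℚ.+-identityˡ r)) s+r≡0

  c₀≡0 : c zero ≡ 0ℚ
  c₀≡0 = *≡0⇒≡0 (begin
    c zero * dot a y                       ≡⟨ ℚ.+-identityʳ _ ⟨
    c zero * dot a y + 0ℚ                  ≡⟨ cong (c zero * dot a y +_) (sumFin-0 cₜa[pₜ]≡0) ⟨
    sumFin (λ t → c t * dot a ((y ∷ p) t)) ≡⟨ dot-lincomb a c (y ∷ p) ⟨
    dot a (lincomb c (y ∷ p))              ≡⟨ dot-cong a Σcq≐0 ⟩
    dot a (λ _ → 0ℚ)                       ≡⟨ dot-zeroʳ a ⟩
    0ℚ                                     ∎) a[y]≢0
    where
    cₜa[pₜ]≡0 : ∀ t → c (suc t) * dot a (p t) ≡ 0ℚ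
    cₜa[pₜ]≡0 t = trans (cong (c (suc t) *_) (a[p]≡0 t)) (ℚ.*-zeroʳ (c (suc t)))

  c₀y≡0 : ∀ k → c zero * y k ≡ 0ℚ
  c₀y≡0 k = trans (cong (_* y k) c₀≡0) (ℚ.*-zeroˡ (y k))

HasDim-cong : ∀ {n} {F F′ : PointSet n} {d} →
  (∀ x → F x → F′ x) → (∀ x → F′ x → F x) → HasDim F d → HasDim F′ d
HasDim-cong F⊆F′ F′⊆F ((p , F[p] , p-indep) , too-big) =
  (p , F⊆F′ _ ∘ F[p] , p-indep) , λ q F′[q] → too-big q (F′⊆F _ ∘ F′[q])

facet⊆properFace⇒facet : ∀ {n} {Q F F′ : PointSet n} (ψ y : Point n) →
  IsFacet Q F → (∀ x → F x → F′ x) → (∀ x → F′ x → Q x × dot ψ x ≡ 0ℚ) →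
  Q y → dot ψ y ≢ 0ℚ → IsFacet Q F′
facet⊆properFace⇒facet {n} {Q} {F} {F′} ψ y
  (a , a≢0 , Q⊆a⁺ , F⇔Q∩a⊥ , d , dimQ , dimF) F⊆F′ F′⊆ψ⊥ Qy ψy≢0 =
  a , a≢0 , Q⊆a⁺ , (λ x → F⇔Q∩a⊥ x .proj₁ ∘ F′⊆F x , F⊆F′ x ∘ F⇔Q∩a⊥ x .proj₂) ,
  d , dimQ , HasDim-cong F⊆F′ F′⊆F dimF
  where
  p : Fin (suc d) → Point n
  p = dimF .proj₁ .proj₁

  F[p] : ∀ t → F (p t)
  F[p] = dimF .proj₁ .proj₂ .proj₁

  -- A point x of F′ off the hyperplane of F would give d + 3 affinely independent
  -- points y, x, p₀, …, p_d of Q, which has dimension d + 1.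
  F′⊆F : ∀ x → F′ x → F x
  F′⊆F x F′x with dot a x ℚ.≟ 0ℚ
  ... | yes ax≡0 = F⇔Q∩a⊥ x .proj₂ (F′⊆ψ⊥ x F′x .proj₁ , ax≡0)
  ... | no  ax≢0 = ⊥-elim (dimQ .proj₂ (y ∷ x ∷ p) Q[yxp] yxp-indep)
    where
    Q[yxp] : ∀ t → Q ((y ∷ x ∷ p) t)
    Q[yxp] zero          = Qy
    Q[yxp] (suc zero)    = F′⊆ψ⊥ x F′x .proj₁
    Q[yxp] (suc (suc t)) = F⇔Q∩a⊥ (p t) .proj₁ (F[p] t) .proj₁

    ψ[xp]≡0 : ∀ t → dot ψ ((x ∷ p) t) ≡ 0ℚ
    ψ[xp]≡0 zero    = F′⊆ψ⊥ x F′x .proj₂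
    ψ[xp]≡0 (suc t) = F′⊆ψ⊥ (p t) (F⊆F′ (p t) (F[p] t)) .proj₂

    yxp-indep : AffinelyIndependent (y ∷ x ∷ p)
    yxp-indep =
      AffinelyIndependent-∷ ψ y
        (AffinelyIndependent-∷ a x (dimF .proj₁ .proj₂ .proj₂)
          (λ t → F⇔Q∩a⊥ (p t) .proj₁ (F[p] t) .proj₂) ax≢0)
        ψ[xp]≡0 ψy≢0

χ : Bool → ℚ
χ b = if b then 1ℚ else 0ℚ

χ-mono : ∀ {b b′} → (b ≡ true → b′ ≡ true) → χ b ≤ χ b′
χ-mono {false} {false} _     = ℚ.≤-refl
χ-mono {false} {true}  _     = ℚ.nonNegative⁻¹ 1ℚ
χ-mono {true}          b⇒b′ rewrite b⇒b′ refl = ℚ.≤-refl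

sumOver≡dotχ : ∀ {n} (S : VSet n) (x : Point n) → sumOver S x ≡ dot (χ ∘ S) x
sumOver≡dotχ S x = sumFin-cong (λ k → if≡χ* (S k) (x k))
  where
  if≡χ* : ∀ b v → (if b then v else 0ℚ) ≡ χ b * v
  if≡χ* true  v = sym (ℚ.*-identityˡ v)
  if≡χ* false v = sym (ℚ.*-zeroˡ v)

sumOver-cong : ∀ {n} {S T : VSet n} → (∀ i → S i ≡ T i) → ∀ x → sumOver S x ≡ sumOver T x
sumOver-cong S≗T x = sumFin-cong (λ i → cong (if_then x i else 0ℚ) (S≗T i))

sumOver-edgeVec : ∀ {n} (S : VSet n) (i j : Fin n) → sumOver S (edgeVec (i , j)) ≡ χ (S i) + χ (S j)
sumOver-edgeVec S i j = trans (sumOver≡dotχ S _) (dot-edgeVec (χ ∘ S) i j)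

slack : ∀ {n} → SimpleGraph n → VSet n → Point n
slack G S k = χ (nbhd G S k) - χ (S k)

dot-slack : ∀ {n} (G : SimpleGraph n) (S : VSet n) (x : Point n) →
  dot (slack G S) x ≡ sumOver (nbhd G S) x - sumOver S x
dot-slack G S x = trans (dot--ˡ (χ ∘ nbhd G S) (χ ∘ S) x)
  (sym (cong₂ _-_ (sumOver≡dotχ (nbhd G S) x) (sumOver≡dotχ S x)))

H⇒dot-slack≡0 : ∀ {n} (G : SimpleGraph n) S {x} → H G S x → dot (slack G S) x ≡ 0ℚ
H⇒dot-slack≡0 G S {x} HSx = trans (dot-slack G S x) (x≈y⇒x∙y⁻¹≈ε (sym HSx))

dot-slack≡0⇒H : ∀ {n} (G : SimpleGraph n) S {x} → dot (slack G S) x ≡ 0ℚ → H G S x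
dot-slack≡0⇒H G S {x} slack≡0 = sym (x∙y⁻¹≈ε⇒x≈y _ _ (trans (sym (dot-slack G S x)) slack≡0))

anyFin⇒∃ : ∀ {m} (f : Fin m → Bool) → anyFin f ≡ true → ∃[ j ] f j ≡ true
anyFin⇒∃ {suc m} f any≡true with f zero in f₀
... | true  = zero , f₀
... | false = let j , fj = anyFin⇒∃ (f ∘ suc) any≡true in suc j , fj

∃⇒anyFin : ∀ {m} (f : Fin m → Bool) j → f j ≡ true → anyFin f ≡ true
∃⇒anyFin f zero    fj rewrite fj = refl
∃⇒anyFin f (suc j) fj with f zero
... | true  = refl
... | false = ∃⇒anyFin (f ∘ suc) j fj

anyFin-cong : ∀ {m} {f g : Fin m → Bool} → (∀ i → f i ≡ g i) → anyFin f ≡ anyFin g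
anyFin-cong {zero}  f≗g = refl
anyFin-cong {suc m} f≗g = cong₂ _∨_ (f≗g zero) (anyFin-cong (f≗g ∘ suc))

anyFin-∨ : ∀ {m} (f g : Fin m → Bool) → anyFin (λ j → f j ∨ g j) ≡ anyFin f ∨ anyFin g
anyFin-∨ {zero}  f g = refl
anyFin-∨ {suc m} f g = begin
  (f zero ∨ g zero) ∨ anyFin (λ j → f (suc j) ∨ g (suc j))
    ≡⟨ cong ((f zero ∨ g zero) ∨_) (anyFin-∨ (f ∘ suc) (g ∘ suc)) ⟩
  (f zero ∨ g zero) ∨ (anyFin (f ∘ suc) ∨ anyFin (g ∘ suc))
    ≡⟨ ∨-interchange (f zero) (g zero) _ _ ⟩
  (f zero ∨ anyFin (f ∘ suc)) ∨ (g zero ∨ anyFin (g ∘ suc)) ∎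
  where
  open import Algebra.Properties.CommutativeSemigroup
    (CommutativeMonoid.commutativeSemigroup 𝔹.∨-commutativeMonoid)
    using () renaming (interchange to ∨-interchange)

nbhd-cong : ∀ {n} (G : SimpleGraph n) {S T : VSet n} → (∀ i → S i ≡ T i) →
  ∀ i → nbhd G S i ≡ nbhd G T i
nbhd-cong G S≗T i = anyFin-cong (λ j → cong (_∧ adj G j i) (S≗T j))

H⁻-cong : ∀ {n} (G : SimpleGraph n) {S T : VSet n} → (∀ i → S i ≡ T i) →
  ∀ {x} → H⁻ G S x → H⁻ G T x
H⁻-cong G S≗T {x} = subst₂ _≤_ (sumOver-cong S≗T x) (sumOver-cong (nbhd-cong G S≗T) x)

∈nbhd : ∀ {n} (G : SimpleGraph n) (S : VSet n) {i j} →
  S j ≡ true → adj G j i ≡ true → nbhd G S i ≡ true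
∈nbhd G S {i} {j} Sj j~i = ∃⇒anyFin (λ j → S j ∧ adj G j i) j (cong₂ _∧_ Sj j~i)

nbhd⇒∃ : ∀ {n} (G : SimpleGraph n) (S : VSet n) {i} → nbhd G S i ≡ true →
  ∃[ j ] S j ≡ true × adj G j i ≡ true
nbhd⇒∃ G S {i} i∈N with anyFin⇒∃ (λ j → S j ∧ adj G j i) i∈N
... | j , Sj∧j~i = j , 𝔹.∧-conical .proj₁ _ _ Sj∧j~i , 𝔹.∧-conical .proj₂ _ _ Sj∧j~i

edgeVec∈EdgeCone : ∀ {n} (G : SimpleGraph n) {i j} → adj G i j ≡ true → EdgeCone G (edgeVec (i , j))
edgeVec∈EdgeCone G {i} {j} i~j =
  1 , (λ _ → i , j) , (λ _ → 1ℚ) , (λ _ → i~j) , (λ _ → ℚ.nonNegative⁻¹ 1ℚ) ,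
  λ k → sym (trans (ℚ.+-identityʳ _) (ℚ.*-identityˡ _))

dot-mono-EdgeCone : ∀ {n} (G : SimpleGraph n) (v w : Point n) →
  (∀ i j → adj G i j ≡ true → v i + v j ≤ w i + w j) →
  ∀ {x} → EdgeCone G x → dot v x ≤ dot w x
dot-mono-EdgeCone G v w edge≤ (m , es , c , es⊆E , c≥0 , x≐Σce) =
  subst₂ _≤_ (sym (on-cone v)) (sym (on-cone w))
    (sumFin-mono-≤ (λ t → ℚ.*-monoˡ-≤-nonNeg (c t) {{nonNegative (c≥0 t)}} (edge≤′ t)))
  where
  on-cone : ∀ u → dot u _ ≡ sumFin (λ t → c t * dot u (edgeVec (es t)))
  on-cone u = trans (dot-cong u x≐Σce) (dot-lincomb u c (edgeVec ∘ es))

  edge≤′ : ∀ t → dot v (edgeVec (es t)) ≤ dot w (edgeVec (es t))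
  edge≤′ t with es t | es⊆E t
  ... | i , j | i~j = subst₂ _≤_ (sym (dot-edgeVec v i j)) (sym (dot-edgeVec w i j)) (edge≤ i j i~j)

EdgeCone⊆H⁻ : ∀ {n} (G : SimpleGraph n) (S : VSet n) {x} → EdgeCone G x → H⁻ G S x
EdgeCone⊆H⁻ G S {x} x∈cone =
  subst₂ _≤_ (sym (sumOver≡dotχ S x)) (sym (sumOver≡dotχ (nbhd G S) x))
    (dot-mono-EdgeCone G (χ ∘ S) (χ ∘ nbhd G S) edge≤ x∈cone)
  where
  edge≤ : ∀ i j → adj G i j ≡ true → χ (S i) + χ (S j) ≤ χ (nbhd G S i) + χ (nbhd G S j)
  edge≤ i j i~j = subst (χ (S i) + χ (S j) ≤_) (ℚ.+-comm (χ (nbhd G S j)) (χ (nbhd G S i)))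
    (ℚ.+-mono-≤ (χ-mono (λ Si → ∈nbhd G S Si i~j))
                (χ-mono (λ Sj → ∈nbhd G S Sj (trans (symm G j i) i~j))))

Walk-exit : ∀ {n} {G : SimpleGraph n} (P : VSet n) {a b} → Walk G a b →
  P a ≡ true → P b ≡ false → ∃[ u ] ∃[ v ] adj G u v ≡ true × P u ≡ true × P v ≡ false
Walk-exit P here Pa Pb with () ← trans (sym Pa) Pb
Walk-exit P (step {i} {j} i~j walk) Pi Pb with P j in Pj
... | false = i , j , i~j , Pi , Pj
... | true  = Walk-exit P walk Pj Pb

-- Along a walk from S to a vertex outside S ∪ N(S) some edge uv leaves S ∪ N(S);
-- then u ∈ N(S) ∖ S and v ∉ S ∪ N(S), so e_u + e_v lies on the strict side of H_S.
EdgeCone⊈H : ∀ {n} (G : SimpleGraph n) → Connected G → (S : VSet n) {a b : Fin n} →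
  S a ≡ true → S b ≡ false → nbhd G S b ≡ false → ∃[ y ] EdgeCone G y × ¬ H G S y
EdgeCone⊈H G conn S {a} {b} Sa Sb Nb
  with Walk-exit (λ w → S w ∨ nbhd G S w) (conn a b) (cong (_∨ nbhd G S a) Sa) (cong₂ _∨_ Sb Nb)
... | u , v , u~v , Su∨Nu , Sv∨Nv
  with 𝔹.∨-conical .proj₁ _ _ Sv∨Nv | 𝔹.∨-conical .proj₂ _ _ Sv∨Nv | S u in Su
... | Sv | Nv | true  with () ← trans (sym Nv) (∈nbhd G S Su u~v)
... | Sv | Nv | false =
  edgeVec (u , v) , edgeVec∈EdgeCone G u~v , λ H[uv] → 0≢1 (begin
    χ false + χ false                    ≡⟨ cong₂ (λ s s′ → χ s + χ s′) Su Sv ⟨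
    χ (S u) + χ (S v)                    ≡⟨ sumOver-edgeVec S u v ⟨
    sumOver S (edgeVec (u , v))          ≡⟨ H[uv] ⟩
    sumOver (nbhd G S) (edgeVec (u , v)) ≡⟨ sumOver-edgeVec (nbhd G S) u v ⟩
    χ (nbhd G S u) + χ (nbhd G S v)      ≡⟨ cong₂ (λ s s′ → χ s + χ s′) Nu Nv ⟩
    χ true + χ false                     ∎)
  where
  Nu : nbhd G S u ≡ true
  Nu = trans (cong (_∨ nbhd G S u) (sym Su)) Su∨Nu

  0≢1 : χ false + χ false ≢ χ true + χ false
  0≢1 ()

_∩_ : ∀ {n} → VSet n → VSet n → VSet n
(S ∩ T) i = S i ∧ T i

∁ : ∀ {n} → VSet n → VSet n
∁ T i = not (T i)

sumOver-∪ : ∀ {n} (S S₁ S₂ : VSet n) → (∀ i → S i ≡ S₁ i ∨ S₂ i) → (∀ i → S₁ i ∧ S₂ i ≡ false) →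
  ∀ x → sumOver S x ≡ sumOver S₁ x + sumOver S₂ x
sumOver-∪ S S₁ S₂ S≗S₁∪S₂ S₁∩S₂≗∅ x = begin
  sumOver S x
    ≡⟨ sumOver-cong S≗S₁∪S₂ x ⟩
  sumFin (λ i → if S₁ i ∨ S₂ i then x i else 0ℚ)
    ≡⟨ sumFin-cong (λ i → if-∨ (S₁ i) (S₂ i) (S₁∩S₂≗∅ i)) ⟩
  sumFin (λ i → (if S₁ i then x i else 0ℚ) + (if S₂ i then x i else 0ℚ))
    ≡⟨ sumFin-+ (λ i → if S₁ i then x i else 0ℚ) _ ⟩
  sumOver S₁ x + sumOver S₂ x ∎
  where
  if-∨ : ∀ b₁ b₂ {v} → b₁ ∧ b₂ ≡ false →
    (if b₁ ∨ b₂ then v else 0ℚ) ≡ (if b₁ then v else 0ℚ) + (if b₂ then v else 0ℚ)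
  if-∨ true  false _ = sym (ℚ.+-identityʳ _)
  if-∨ false true  _ = sym (ℚ.+-identityˡ _)
  if-∨ false false _ = refl

∧-split : ∀ s t → s ≡ (s ∧ t) ∨ (s ∧ not t)
∧-split true  true  = refl
∧-split true  false = refl
∧-split false _     = refl

sumOver-∩∁ : ∀ {n} (S T : VSet n) x → sumOver S x ≡ sumOver (S ∩ T) x + sumOver (S ∩ ∁ T) x
sumOver-∩∁ S T =
  sumOver-∪ S (S ∩ T) (S ∩ ∁ T) (λ i → ∧-split (S i) (T i)) (λ i → disjoint (S i) (T i))
  where
  disjoint : ∀ s t → (s ∧ t) ∧ (s ∧ not t) ≡ false
  disjoint true  true  = refl
  disjoint true  false = refl
  disjoint false _     = refl

nbhd-∩∁ : ∀ {n} (G : SimpleGraph n) (S T : VSet n) i →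
  nbhd G S i ≡ nbhd G (S ∩ T) i ∨ nbhd G (S ∩ ∁ T) i
nbhd-∩∁ G S T i =
  trans (anyFin-cong (λ j → trans (cong (_∧ adj G j i) (∧-split (S j) (T j)))
                                  (𝔹.∧-distribʳ-∨ (adj G j i) ((S ∩ T) j) ((S ∩ ∁ T) j))))
        (anyFin-∨ (λ j → (S ∩ T) j ∧ adj G j i) (λ j → (S ∩ ∁ T) j ∧ adj G j i))

nbhd-∩-across : ∀ {n} (G : SimpleGraph n) {side} → IsBipartition G side → ∀ S T {i} →
  nbhd G (S ∩ T) i ≡ true → ∃[ j ] T j ≡ true × side i ≡ not (side j)
nbhd-∩-across G bip S T i∈N with nbhd⇒∃ G (S ∩ T) i∈N
... | j , Sj∧Tj , j~i = j , 𝔹.∧-conical .proj₂ _ _ Sj∧Tj , 𝔹.¬-not (λ i≡j → bip j _ j~i (sym i≡j))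

nbhd-∩-side-disjoint : ∀ {n} (G : SimpleGraph n) {side} → IsBipartition G side → ∀ S i →
  nbhd G (S ∩ side) i ∧ nbhd G (S ∩ ∁ side) i ≡ false
nbhd-∩-side-disjoint G {side} bip S i
  with nbhd G (S ∩ side) i in N₁i | nbhd G (S ∩ ∁ side) i in N₂i
... | false | _     = refl
... | true  | false = refl
... | true  | true
  with _ , V₁j₁ , i≡¬j₁ ← nbhd-∩-across G bip S side N₁i
     | _ , V₂j₂ , i≡¬j₂ ← nbhd-∩-across G bip S (∁ side) N₂i
  with () ← trans (sym (trans i≡¬j₁ (cong not V₁j₁))) (trans i≡¬j₂ V₂j₂)

sumOver-nbhd-∩-side : ∀ {n} (G : SimpleGraph n) {side} → IsBipartition G side → ∀ S x →
  sumOver (nbhd G S) x ≡ sumOver (nbhd G (S ∩ side)) x + sumOver (nbhd G (S ∩ ∁ side)) x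
sumOver-nbhd-∩-side G {side} bip S =
  sumOver-∪ (nbhd G S) _ _ (nbhd-∩∁ G S side) (nbhd-∩-side-disjoint G bip S)

module _ {n} (G : SimpleGraph n) {side : VSet n} (bip : IsBipartition G side)
         (S : VSet n) {x : Point n} where

  H⁻-∩-side : H⁻ G (S ∩ side) x → H⁻ G (S ∩ ∁ side) x → H⁻ G S x
  H⁻-∩-side H⁻₁ H⁻₂ =
    subst₂ _≤_ (sym (sumOver-∩∁ S side x)) (sym (sumOver-nbhd-∩-side G bip S x))
      (ℚ.+-mono-≤ H⁻₁ H⁻₂)

  -- On the cone both halves of H_S⁻ are valid, so equality in their sum forces equality in each.
  H-∩-side : EdgeCone G x → H G S x → H G (S ∩ side) x × H G (S ∩ ∁ side) x
  H-∩-side x∈cone H =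
    +-mono-≤-≡⇒≡ (EdgeCone⊆H⁻ G (S ∩ side) x∈cone) (EdgeCone⊆H⁻ G (S ∩ ∁ side) x∈cone)
      (trans (sym (sumOver-∩∁ S side x)) (trans H (sumOver-nbhd-∩-side G bip S x)))

InFamily-⊆ : ∀ {n} {G : SimpleGraph n} → Connected G → ∀ {A} → InFamily G A → (S : VSet n) →
  (∀ j → S j ≡ true → A j ≡ true) → (∀ x → EdgeCone G x → H G A x → H G S x) →
  ∀ {a b} → S a ≡ true → A b ≡ true → S b ≡ false → InFamily G S
InFamily-⊆ {G = G} conn (A-indep , A-facet) S S⊆A H_A⊆H_S {b = b} Sa Ab Sb =
  let y , y∈cone , y∉H = EdgeCone⊈H G conn S Sa Sb b∉N[S] in
  S-indep ,
  facet⊆properFace⇒facet (slack G S) y A-facet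
    (λ x (x∈cone , H_Ax) → x∈cone , H_A⊆H_S x x∈cone H_Ax)
    (λ x (x∈cone , H_Sx) → x∈cone , H⇒dot-slack≡0 G S H_Sx)
    y∈cone (y∉H ∘ dot-slack≡0⇒H G S)
  where
  S-indep : Independent G S
  S-indep i j Si Sj = A-indep i j (S⊆A i Si) (S⊆A j Sj)

  b∉N[S] : nbhd G S b ≡ false
  b∉N[S] with nbhd G S b in b∈N
  ... | false = refl
  ... | true with j , Sj , j~b ← nbhd⇒∃ G S b∈N
               with () ← trans (sym j~b) (A-indep j b (S⊆A j Sj) Ab)

≢-at : ∀ {n} {S T : VSet n} {i} → S i ≡ false → T i ≡ true → ¬ (∀ j → S j ≡ T j)
≢-at Si Ti S≗T with () ← trans (sym Si) (trans (S≗T _) Ti)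

proposition4p2 : ∀ {n} (G : SimpleGraph n) (side : Fin n → Bool) →
    Connected G → IsBipartition G side →
    (A : VSet n) → InFamily G A →
    (∃[ i ] (A i ≡ true × side i ≡ true)) →
    (∃[ i ] (A i ≡ true × side i ≡ false)) →
    ∀ x → (FullIntersection G x → OmitIntersection G A x) ×
    (OmitIntersection G A x → FullIntersection G x)
proposition4p2 G side conn bip A A∈𝓕 (a , Aa , V₁a) (b , Ab , V₂b) x =
  (λ (x∈aff , x∈H⁻ , x≥0) → x∈aff , (λ B B∈𝓕 _ → x∈H⁻ B B∈𝓕) , x≥0) ,
  (λ (x∈aff , x∈H⁻ , x≥0) → x∈aff , H⁻-from-rest x∈H⁻ , x≥0)
  where
  A₁∈𝓕 : InFamily G (A ∩ side)
  A₁∈𝓕 = InFamily-⊆ conn A∈𝓕 (A ∩ side) (λ j → 𝔹.∧-conical .proj₁ (A j) _)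
    (λ y y∈cone → proj₁ ∘ H-∩-side G bip A y∈cone)
    (cong₂ _∧_ Aa V₁a) Ab (cong₂ _∧_ Ab V₂b)

  A₂∈𝓕 : InFamily G (A ∩ ∁ side)
  A₂∈𝓕 = InFamily-⊆ conn A∈𝓕 (A ∩ ∁ side) (λ j → 𝔹.∧-conical .proj₁ (A j) _)
    (λ y y∈cone → proj₂ ∘ H-∩-side G bip A y∈cone)
    (cong₂ _∧_ Ab (cong not V₂b)) Aa (cong₂ _∧_ Aa (cong not V₁a))

  H⁻-from-rest : (∀ B → InFamily G B → ¬ (∀ i → B i ≡ A i) → H⁻ G B x) →
    ∀ B → InFamily G B → H⁻ G B x
  H⁻-from-rest x∈H⁻ B B∈𝓕 with Fin.all? (λ i → B i 𝔹.≟ A i)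
  ... | no  B≢A = x∈H⁻ B B∈𝓕 B≢A
  ... | yes B≗A = H⁻-cong G (sym ∘ B≗A) (H⁻-∩-side G bip A
        (x∈H⁻ (A ∩ side)   A₁∈𝓕 (≢-at (cong₂ _∧_ Ab V₂b) Ab))
        (x∈H⁻ (A ∩ ∁ side) A₂∈𝓕 (≢-at (cong₂ _∧_ Aa (cong not V₁a)) Aa)))
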